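{- Let $N,M\in\mathbb{N}$ and let $B\subseteq[N]$ be $M$-homogeneous in $[N]$. Then $$|B|\ \ge\ \frac1M\Bigl\lfloor\frac NM\Bigr\rfloor.$$
   Context: $[N]=\{1,\dots,N\}$. For $q\in\mathbb{N}$, $q\cdot[M]=\{q,2q,\dots,Mq\}$. Given $S\subseteq\mathbb{N}$, a set $B$ is $M$-homogeneous in $S$ if $B\cap q\cdot[M]\neq\emptyset$ for every $q\in\mathbb{N}$ with $q\cdot[M]\subseteq S$. -}

module Defs where

open import Data.Nat using (ℕ; _*_; _≤_; _<_)
open import Data.Product using (_×_; ∃-syntax)
open import Data.List using (List)
open import Data.List.Membership.Propositional using (_∈_)

_∈[_] : ℕ → ℕ → Set
x ∈[ N ] = 1 ≤ x × x ≤ N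

Homogeneous : ℕ → ℕ → List ℕ → Set
Homogeneous M N B =
  ∀ (q : ℕ) → 1 ≤ q →
  (∀ (k : ℕ) → k ∈[ M ] → (q * k) ∈[ N ]) →
  ∃[ k ] (k ∈[ M ] × (q * k) ∈ B)

{-# OPTIONS --safe #-}
module Submission where

-- Every q ≤ ⌊N/M⌋ has q·[M] ⊆ [N], so homogeneity picks an element q·k of B with
-- k ∈ [M]. The pair (q·k, k) determines q, so q ↦ (q·k, k) injects [⌊N/M⌋] into
-- B × [M], and ⌊N/M⌋ ≤ |B|·M.

open import Defs
open import Data.Nat using (ℕ; suc; _*_; _≤_; _/_; NonZero; s≤s; z≤n)
open import Data.Nat.Properties using (*-mono-≤; *-monoˡ-≤; *-monoʳ-≤; *-comm; ≤-trans; ≤-reflexive; *-cancelʳ-≡; suc-injective)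
open import Data.Nat.DivMod using (m/n*n≤m)
open import Data.List using (List; length; lookup)
open import Data.List.Relation.Unary.All using (All)
open import Data.List.Relation.Unary.Unique.Propositional using (Unique)
open import Data.List.Relation.Unary.Any using (index)
open import Data.List.Relation.Unary.Any.Properties using (lookup-index)
open import Data.List.Membership.Propositional using (_∈_)
open import Data.Fin using (Fin; toℕ; fromℕ<; combine)
open import Data.Fin.Properties using (fromℕ<-injective; toℕ<n; toℕ-injective; combine-injective; injective⇒≤)
open import Data.Product using (_,_; _×_; ∃-syntax)
open import Relation.Binary.PropositionalEquality using (_≡_; refl; sym; trans; cong)

private variable
  k k′ M N q : ℕ

toFin : k ∈[ M ] → Fin M
toFin {suc k} (_ , k<M) = fromℕ< k<M

toFin-injective : (p : k ∈[ M ]) (p′ : k′ ∈[ M ]) → toFin p ≡ toFin p′ → k ≡ k′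
toFin-injective {suc k} {_} {suc k′} (_ , k<M) (_ , k′<M) eq =
  cong suc (fromℕ<-injective k k′ k<M k′<M eq)

multiples-⊆-[N] : 1 ≤ q → q * M ≤ N → ∀ k → k ∈[ M ] → (q * k) ∈[ N ]
multiples-⊆-[N] {q} 1≤q qM≤N k (1≤k , k≤M) =
  *-mono-≤ 1≤q 1≤k , ≤-trans (*-monoʳ-≤ q k≤M) qM≤N

length-≥-of-meeting-multiples : ∀ L M (B : List ℕ) →
  (∀ q → 1 ≤ q → q ≤ L → ∃[ k ] (k ∈[ M ] × (q * k) ∈ B)) →
  L ≤ length B * M
length-≥-of-meeting-multiples L M B meets = injective⇒≤ code-injective
  where
  hit : (i : Fin L) → ∃[ k ] (k ∈[ M ] × (suc (toℕ i) * k) ∈ B)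
  hit i = meets (suc (toℕ i)) (s≤s z≤n) (toℕ<n i)

  code : Fin L → Fin (length B * M)
  code i with hit i
  ... | _ , k∈[M] , qk∈B = combine (index qk∈B) (toFin k∈[M])

  code-injective : ∀ {i j} → code i ≡ code j → i ≡ j
  code-injective {i} {j} eq with hit i | hit j
  ... | suc k , k∈[M] , qk∈B | k′ , k′∈[M] , q′k′∈B
    with combine-injective (index qk∈B) (toFin k∈[M]) (index q′k′∈B) (toFin k′∈[M]) eq
  ... | same-position , same-factor
    with refl ← toFin-injective k∈[M] k′∈[M] same-factor
    = toℕ-injective (suc-injective (*-cancelʳ-≡ _ _ (suc k) same-product))
    where
    same-product : suc (toℕ i) * suc k ≡ suc (toℕ j) * suc k
    same-product = trans (lookup-index qk∈B)
                         (trans (cong (lookup B) same-position) (sym (lookup-index q′k′∈B)))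

lemma4p2 : (N M : ℕ) → .{{_ : NonZero M}} → (B : List ℕ) →
    Unique B → All (λ x → x ∈[ N ]) B →
    Homogeneous M N B →
    N / M ≤ M * length B
lemma4p2 N M B _ _ homogeneous =
  ≤-trans (length-≥-of-meeting-multiples (N / M) M B meets) (≤-reflexive (*-comm (length B) M))
  where
  meets : ∀ q → 1 ≤ q → q ≤ N / M → ∃[ k ] (k ∈[ M ] × (q * k) ∈ B)
  meets q 1≤q q≤N/M =
    homogeneous q 1≤q (multiples-⊆-[N] 1≤q (≤-trans (*-monoˡ-≤ M q≤N/M) (m/n*n≤m N M)))
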